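{- Let $G=(V,E)$ be a graph and let $(V_1,U,V_2)$ with grouping $\mathcal{U}$ be a node cutset separation of $G$. Let $G_1=G_{V_1\cup U}$ and $G_2=G_{V_2\cup U}$, let $\mathcal{L}_1$ be a collection of cliques in $G_1$ and $\mathcal{L}_2$ a collection of cliques in $G_2$. Then every $x\in\mathbb{R}^{V\cup\mathcal{R}(U)}$ satisfies $$x\in P(G(U),\mathcal{L}_1\cup\mathcal{L}_2\cup\mathcal{L}(U))\iff x_{G_1(U)}\in P(G_1(U),\mathcal{L}_1\cup\mathcal{L}(U))\text{ and }x_{G_2(U)}\in P(G_2(U),\mathcal{L}_2\cup\mathcal{L}(U)).$$ Consequently, $$P(G)=\{x\in\mathbb{R}^V:\exists y\in\mathbb{R}^{\mathcal{R}(U)}\,[(x_{G_1},y)\in P(G_1(U),\mathcal{L}(U))\text{ and }(x_{G_2},y)\in P(G_2(U),\mathcal{L}(U))]\}.$$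
   Context: For $X\subseteq V$, $G_X$ is the induced subgraph on $X$; for a vector $x$ and a graph $H$ whose node set is a subset of the index set, $x_H$ denotes the restriction of $x$ to the nodes of $H$. Disjoint sets $X,Y$ are adjacent if some node of $X$ has a neighbor in $Y$, fully adjacent if every node of $X$ is adjacent to every node of $Y$. For a graph $H$ and nonempty $X\subseteq V(H)$, $X$ is a group of $H$ if $X$ is fully adjacent to the set of nodes outside $X$ having a neighbor in $X$; a grouping of $A$ in $H$ is a partition of $A$ into groups of $H$. A node cutset separation of $G$ is a triple $(V_1,U,V_2)$ of disjoint sets with union $V$ together with a grouping $\mathcal{U}$ of $U$ in $G_{V_2\cup U}$ such that $V_1$ and $V_2$ are nonadjacent, $|V_1\cup U|>|\mathcal{U}|$ and $|V_2|>0$. For $U\subseteq V(H)$, the record graph $H(U)$ is obtained from $H$ by adding a clique $\mathcal{R}(U)$ of new nodes $r_S$, one for each stable set $S$ of $G_U$ (including $\emptyset$), where $r_S$ is adjacent to all nodes of $U\setminus S$ and to no other node of $H$ (the same set $\mathcal{R}(U)$ is used for $G,G_1,G_2$ since they induce the same graph on $U$). $\mathcal{L}(U)$ is the collection consisting of the clique $\mathcal{R}(U)$ together with the cliques $\{v\}\cup\{r_T: T \text{ stable in } G_U,\ v\notin T\}$ for $v\in U$. For a graph $H$ and a collection $\mathcal{L}$ of cliques of $H$, $P(H,\mathcal{L})$ is the convex hull of characteristic vectors of stable sets of $H$ that intersect every member of $\mathcal{L}$, and $P(H)=P(H,\emptyset)$ is the stable set polytope. -}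

module Defs where

open import Level using (0ℓ)
open import Data.Nat using (ℕ; _<_)
open import Data.Bool using (Bool; true; false; not; _∧_; _∨_; T; if_then_else_)
open import Data.Bool.Properties using () renaming (_≟_ to _≟ᵇ_)
open import Data.Fin using (Fin; _≟_)
open import Data.Fin.Subset using (Subset; _∪_; ∣_∣)
open import Data.Vec using (lookup)
open import Data.Vec.Properties using (≡-dec)
open import Data.List using (List; []; _∷_; _++_; map; foldr; length; allFin)
import Data.List as List
open import Data.List.Relation.Unary.All using (All)
open import Data.Product using (Σ; ∃; _×_; _,_; proj₁; proj₂)
open import Data.Sum using (_⊎_; inj₁; inj₂; [_,_])
open import Relation.Nullary using (¬_; ⌊_⌋)
open import Relation.Binary.PropositionalEquality using (_≡_; _≢_)
open import Algebra.Structures using (IsCommutativeRing)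
open import Relation.Binary.Structures using (IsTotalOrder)

-- Ordered fields (the scalar field; ℝ is an instance).

record OrderedField : Set₁ where
  infixl 6 _+_
  infixl 7 _*_
  infix 4 _≤_
  field
    Carrier : Set
    _+_ _*_ : Carrier → Carrier → Carrier
    -_ : Carrier → Carrier
    0# 1# : Carrier
    _≤_ : Carrier → Carrier → Set
    isCommutativeRing : IsCommutativeRing _≡_ _+_ _*_ -_ 0# 1#
    0≢1 : 0# ≢ 1#
    inverse : ∀ x → x ≢ 0# → ∃ λ y → x * y ≡ 1#
    isTotalOrder : IsTotalOrder _≡_ _≤_
    +-mono-≤ : ∀ {x y} z → x ≤ y → x + z ≤ y + z
    *-nonneg : ∀ {x y} → 0# ≤ x → 0# ≤ y → 0# ≤ x * y

record Graph (A : Set) : Set where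
  field
    nodes : A → Bool
    adj   : A → A → Bool
open Graph public

induced : ∀ {A} → Graph A → (A → Bool) → Graph A
induced H X = record { nodes = λ a → nodes H a ∧ X a ; adj = adj H }

Stable : ∀ {A} → Graph A → (A → Bool) → Set
Stable H S = (∀ a → S a ≡ true → nodes H a ≡ true)
           × (∀ a b → S a ≡ true → S b ≡ true → adj H a b ≡ false)

Clique : ∀ {A} → Graph A → (A → Bool) → Set
Clique H C = (∀ a → C a ≡ true → nodes H a ≡ true)
           × (∀ a b → C a ≡ true → C b ≡ true → a ≢ b → adj H a b ≡ true)

Meets : ∀ {A} → (A → Bool) → (A → Bool) → Set
Meets S C = ∃ λ a → S a ≡ true × C a ≡ true

-- P(H, L): convex hull of characteristic vectors of stable sets of H
-- meeting every member of L; x ∈ P(H,L) refers only to x restricted to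
-- the nodes of H (i.e. x_H ∈ P(H,L)).

module _ (F : OrderedField) where
  open OrderedField F

  Combination : Set → Set
  Combination A = List (Carrier × (A → Bool))

  totalWeight : ∀ {A} → Combination A → Carrier
  totalWeight = foldr (λ p acc → proj₁ p + acc) 0#

  valueAt : ∀ {A} → Combination A → A → Carrier
  valueAt c a = foldr (λ p acc → if proj₂ p a then proj₁ p + acc else acc) 0# c

  InP : ∀ {A} → Graph A → List (A → Bool) → (A → Carrier) → Set
  InP {A} H L x = Σ (Combination A) λ c →
      All (λ p → 0# ≤ proj₁ p) c
    × totalWeight c ≡ 1#
    × All (λ p → Stable H (proj₂ p) × All (Meets (proj₂ p)) L) c
    × (∀ a → nodes H a ≡ true → x a ≡ valueAt c a)

module _ {n : ℕ} where

  _∈ₛ_ : Fin n → Subset n → Set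
  v ∈ₛ S = lookup S v ≡ true

  mkGraph : (Fin n → Fin n → Bool) → Graph (Fin n)
  mkGraph E = record { nodes = λ _ → true ; adj = E }

  _[_] : Graph (Fin n) → Subset n → Graph (Fin n)
  H [ X ] = induced H (lookup X)

  allᵇ : (Fin n → Bool) → List (Fin n) → Bool
  allᵇ p = foldr (λ x b → p x ∧ b) true

  stableᵇ : Graph (Fin n) → Subset n → Bool
  stableᵇ H S = allᵇ (λ u → not (lookup S u) ∨ (nodes H u ∧
                   allᵇ (λ v → not (lookup S v) ∨ not (adj H u v)) (allFin n)))
                 (allFin n)

  -- the nodes r_S of R(U): one per stable set S of G_U (including ∅)
  RNode : Graph (Fin n) → Subset n → Set
  RNode G U = Σ (Subset n) λ S → T (stableᵇ (G [ U ]) S)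

  RecNode : Graph (Fin n) → Subset n → Set
  RecNode G U = Fin n ⊎ RNode G U

  -- record graph H(U) for a graph H on (a subset of) V, where G_U is the
  -- graph defining R(U) (H and G induce the same graph on U)
  recordGraph : (G : Graph (Fin n)) (U : Subset n) → Graph (Fin n) → Graph (RecNode G U)
  recordGraph G U H = record { nodes = nd ; adj = ad }
    where
    nd : RecNode G U → Bool
    nd (inj₁ v) = nodes H v
    nd (inj₂ _) = true
    ad : RecNode G U → RecNode G U → Bool
    ad (inj₁ u) (inj₁ v) = adj H u v
    ad (inj₁ v) (inj₂ (S , _)) = lookup U v ∧ not (lookup S v)
    ad (inj₂ (S , _)) (inj₁ v) = lookup U v ∧ not (lookup S v)
    ad (inj₂ (S , _)) (inj₂ (S' , _)) = not ⌊ ≡-dec _≟ᵇ_ S S' ⌋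

  CliqueₛOf : Graph (Fin n) → Subset n → Set
  CliqueₛOf H C = Clique H (lookup C)

  liftClique : (G : Graph (Fin n)) (U : Subset n) → Subset n → RecNode G U → Bool
  liftClique G U C (inj₁ v) = lookup C v
  liftClique G U C (inj₂ _) = false

  liftCliques : (G : Graph (Fin n)) (U : Subset n) → List (Subset n) → List (RecNode G U → Bool)
  liftCliques G U = map (liftClique G U)

  RClique : (G : Graph (Fin n)) (U : Subset n) → RecNode G U → Bool
  RClique G U (inj₁ _) = false
  RClique G U (inj₂ _) = true

  vClique : (G : Graph (Fin n)) (U : Subset n) → Fin n → RecNode G U → Bool
  vClique G U v (inj₁ u) = ⌊ u ≟ v ⌋
  vClique G U v (inj₂ (S , _)) = not (lookup S v)

  LU : (G : Graph (Fin n)) (U : Subset n) → List (RecNode G U → Bool)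
  LU G U = RClique G U ∷ map (vClique G U) (List.filterᵇ (lookup U) (allFin n))

  IsGroup : Graph (Fin n) → Subset n → Set
  IsGroup H X = (∀ v → v ∈ₛ X → nodes H v ≡ true)
              × (∃ λ v → v ∈ₛ X)
              × (∀ a b → a ∈ₛ X → nodes H b ≡ true → lookup X b ≡ false →
                   (∃ λ c → c ∈ₛ X × adj H c b ≡ true) → adj H a b ≡ true)

  IsGrouping : Graph (Fin n) → Subset n → List (Subset n) → Set
  IsGrouping H A 𝒰 = All (IsGroup H) 𝒰
                   × All (λ X → ∀ v → v ∈ₛ X → v ∈ₛ A) 𝒰
                   × (∀ v → v ∈ₛ A → ∃ λ i → v ∈ₛ List.lookup 𝒰 i)
                   × (∀ i j v → v ∈ₛ List.lookup 𝒰 i → v ∈ₛ List.lookup 𝒰 j → i ≡ j)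

  NodeCutsetSeparation : Graph (Fin n) → (V₁ U V₂ : Subset n) → List (Subset n) → Set
  NodeCutsetSeparation G V₁ U V₂ 𝒰 =
      (∀ v → (v ∈ₛ V₁ × lookup U v ≡ false × lookup V₂ v ≡ false)
           ⊎ (lookup V₁ v ≡ false × v ∈ₛ U × lookup V₂ v ≡ false)
           ⊎ (lookup V₁ v ≡ false × lookup U v ≡ false × v ∈ₛ V₂))
    × IsGrouping (G [ V₂ ∪ U ]) U 𝒰
    × (∀ u v → u ∈ₛ V₁ → v ∈ₛ V₂ → adj G u v ≡ false)
    × length 𝒰 < ∣ V₁ ∪ U ∣
    × 0 < ∣ V₂ ∣

module Submission where

-- A stable set of G(U) meeting every clique of L(U) contains exactly one record node r_R, and then
-- its trace on U is R. So a valid set S of G₁(U) and a valid set T of G₂(U) through the same record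
-- node agree on U ∪ R(U), and S ∪ T is stable in G(U) because V₁ and V₂ are nonadjacent. If x lies
-- in both side polytopes, the two convex combinations put the same weight x(r) on every record
-- node r, so their sets can be coupled through the record nodes, splitting weights where needed;
-- the unions of the coupled pairs then represent x in G(U). The converse is restriction. For the
-- projection formula take L₁ = L₂ = ∅ and extend a stable set S of G by the record node r_{S ∩ U}.

open import Defs
open import Level using (0ℓ)
open import Algebra.Bundles using (AbelianGroup)
open import Algebra.Structures using (IsCommutativeRing)
import Algebra.Properties.AbelianGroup as AbelianGroupProperties
import Algebra.Properties.CommutativeSemigroup as CommutativeSemigroupProperties
open import Data.Nat using (ℕ)
open import Data.Bool using (Bool; true; false; not; _∧_; _∨_; T; if_then_else_)
open import Data.Bool.Properties
  using ( T-≡; T-irrelevant; not-injective; ∨-zeroʳ; ∨-identityʳ; ∨-idem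
        ; ∧-identityʳ; ∧-conicalˡ; ∧-conicalʳ)
  renaming (_≟_ to _≟ᵇ_)
open import Data.Empty using (⊥-elim)
open import Data.Fin using (Fin; _≟_)
open import Data.Fin.Subset using (Subset; _∪_)
open import Data.List using (List; []; _∷_; _++_; map; allFin)
open import Data.List.Properties using (map-++; map-∘; map-id)
open import Data.List.Membership.Propositional.Properties using (∈-map⁺; ∈-filter⁺; ∈-allFin)
open import Data.List.Relation.Unary.All using (All; []; _∷_)
import Data.List.Relation.Unary.All as All
import Data.List.Relation.Unary.All.Properties as Allₚ
open import Data.Product using (∃; _×_; proj₁; proj₂; _,′_)
open import Data.Sum using (_⊎_; inj₁; inj₂; [_,_])
open import Data.Unit using (tt)
open import Data.Vec using (lookup; tabulate)
open import Data.Vec.Properties using (≡-dec; lookup-zipWith; lookup∘tabulate)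
open import Function using (_∘_)
open import Function.Bundles using (_⇔_; mk⇔; Equivalence)
open import Relation.Nullary using (Dec; yes; no; ⌊_⌋)
open import Relation.Nullary.Decidable using (T?)
open import Relation.Binary.PropositionalEquality
  using (_≡_; refl; sym; trans; cong; cong₂; subst; subst₂; module ≡-Reasoning)
open import Relation.Binary.Structures using (IsTotalOrder)

∨-true : ∀ x {y} → x ∨ y ≡ true → x ≡ true ⊎ y ≡ true
∨-true true _ = inj₁ refl
∨-true false y = inj₂ y

∨-agree : ∀ {x y} → x ≡ y → x ∨ y ≡ y
∨-agree {x} refl = ∨-idem x

isYes-sound : ∀ {p} {P : Set p} (d : Dec P) → ⌊ d ⌋ ≡ true → P
isYes-sound (yes p) _ = p

isYes-complete : ∀ {p} {P : Set p} (d : Dec P) → P → ⌊ d ⌋ ≡ true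
isYes-complete (yes _) _ = refl
isYes-complete (no ¬p) p = ⊥-elim (¬p p)

module OrderedFieldProperties (F : OrderedField) where
  open OrderedField F
  open IsCommutativeRing isCommutativeRing
    using (+-isAbelianGroup; +-comm; +-assoc; +-identityˡ; +-identityʳ; -‿inverseʳ)
  module ≤ = IsTotalOrder isTotalOrder

  +-abelianGroup : AbelianGroup 0ℓ 0ℓ
  +-abelianGroup = record { isAbelianGroup = +-isAbelianGroup }

  open AbelianGroupProperties +-abelianGroup public
    using () renaming (∙-cancelˡ to +-cancelˡ; xyx⁻¹≈y to x+y-x≡y)
  open CommutativeSemigroupProperties
    (AbelianGroup.commutativeSemigroup +-abelianGroup) public
    using () renaming (x∙yz≈y∙xz to x+[y+z]≡y+[x+z])

  x+[y-x]≡y : ∀ x y → x + (y + - x) ≡ y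
  x+[y-x]≡y x y = trans (sym (+-assoc x y (- x))) (x+y-x≡y x y)

  x≤y⇒0≤y-x : ∀ {x y} → x ≤ y → 0# ≤ y + - x
  x≤y⇒0≤y-x {x} {y} x≤y = subst (_≤ y + - x) (-‿inverseʳ x) (+-mono-≤ (- x) x≤y)

  x≤y+z⇒x-y≤z : ∀ {x} y z → x ≤ y + z → x + - y ≤ z
  x≤y+z⇒x-y≤z {x} y z x≤y+z = subst (x + - y ≤_) (x+y-x≡y y z) (+-mono-≤ (- y) x≤y+z)

  x≤x+y : ∀ x {y} → 0# ≤ y → x ≤ x + y
  x≤x+y x {y} 0≤y = subst₂ _≤_ (+-identityˡ x) (+-comm y x) (+-mono-≤ x 0≤y)

  +-nonneg : ∀ {x y} → 0# ≤ x → 0# ≤ y → 0# ≤ x + y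
  +-nonneg {x} 0≤x 0≤y = ≤.trans 0≤x (x≤x+y x 0≤y)

  nonneg-sum-zeroˡ : ∀ {x y} → 0# ≤ x → 0# ≤ y → x + y ≡ 0# → x ≡ 0#
  nonneg-sum-zeroˡ {x} 0≤x 0≤y x+y≡0 = ≤.antisym (subst (x ≤_) x+y≡0 (x≤x+y x 0≤y)) 0≤x

  nonneg-sum-zeroʳ : ∀ {x y} → 0# ≤ x → 0# ≤ y → x + y ≡ 0# → y ≡ 0#
  nonneg-sum-zeroʳ {x} {y} 0≤x 0≤y x+y≡0 =
    nonneg-sum-zeroˡ 0≤y 0≤x (trans (+-comm y x) x+y≡0)

module Combinations (F : OrderedField) where
  open import Data.Product using (_,_)
  open OrderedField F
  open IsCommutativeRing isCommutativeRing using (+-comm; +-assoc; +-identityˡ; +-identityʳ)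
  open OrderedFieldProperties F
  open ≡-Reasoning

  module _ {A : Set} where

    NonNegative : Combination F A → Set
    NonNegative = All (λ p → 0# ≤ proj₁ p)

    totalWeight-++ : (c d : Combination F A) → totalWeight F (c ++ d) ≡ totalWeight F c + totalWeight F d
    totalWeight-++ [] d = sym (+-identityˡ (totalWeight F d))
    totalWeight-++ ((w , S) ∷ c) d =
      trans (cong (w +_) (totalWeight-++ c d)) (sym (+-assoc w (totalWeight F c) (totalWeight F d)))

    valueAt-++ : (c d : Combination F A) (a : A) → valueAt F (c ++ d) a ≡ valueAt F c a + valueAt F d a
    valueAt-++ [] d a = sym (+-identityˡ (valueAt F d a))
    valueAt-++ ((w , S) ∷ c) d a with S a
    ... | true = trans (cong (w +_) (valueAt-++ c d a)) (sym (+-assoc w (valueAt F c a) (valueAt F d a)))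
    ... | false = valueAt-++ c d a

    valueAt-∷ : ∀ w S (c : Combination F A) a
              → valueAt F ((w , S) ∷ c) a ≡ (if S a then w else 0#) + valueAt F c a
    valueAt-∷ w S c a with S a
    ... | true = refl
    ... | false = sym (+-identityˡ (valueAt F c a))

    valueAt-∷-+ʳ : ∀ w S (c r : Combination F A) a X → valueAt F c a ≡ X + valueAt F r a
                 → valueAt F ((w , S) ∷ c) a ≡ X + valueAt F ((w , S) ∷ r) a
    valueAt-∷-+ʳ w S c r a X c≡X+r = begin
      valueAt F ((w , S) ∷ c) a                         ≡⟨ valueAt-∷ w S c a ⟩
      (if S a then w else 0#) + valueAt F c a           ≡⟨ cong (_ +_) c≡X+r ⟩
      (if S a then w else 0#) + (X + valueAt F r a)     ≡⟨ x+[y+z]≡y+[x+z] _ X _ ⟩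
      X + ((if S a then w else 0#) + valueAt F r a)     ≡⟨ cong (X +_) (valueAt-∷ w S r a) ⟨
      X + valueAt F ((w , S) ∷ r) a                     ∎

    valueAt-∷-+ˡ : ∀ w S (c t : Combination F A) a Y → valueAt F c a ≡ valueAt F t a + Y
                 → valueAt F ((w , S) ∷ c) a ≡ valueAt F ((w , S) ∷ t) a + Y
    valueAt-∷-+ˡ w S c t a Y c≡t+Y = begin
      valueAt F ((w , S) ∷ c) a                         ≡⟨ valueAt-∷ w S c a ⟩
      (if S a then w else 0#) + valueAt F c a           ≡⟨ cong (_ +_) c≡t+Y ⟩
      (if S a then w else 0#) + (valueAt F t a + Y)     ≡⟨ +-assoc _ _ Y ⟨
      ((if S a then w else 0#) + valueAt F t a) + Y     ≡⟨ cong (_+ Y) (valueAt-∷ w S t a) ⟨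
      valueAt F ((w , S) ∷ t) a + Y                     ∎

    totalWeight-nonneg : ∀ c → NonNegative c → 0# ≤ totalWeight F c
    totalWeight-nonneg [] [] = ≤.refl
    totalWeight-nonneg (_ ∷ c) (0≤w ∷ nn) = +-nonneg 0≤w (totalWeight-nonneg c nn)

    valueAt-nonneg : ∀ c a → NonNegative c → 0# ≤ valueAt F c a
    valueAt-nonneg [] a [] = ≤.refl
    valueAt-nonneg ((w , S) ∷ c) a (0≤w ∷ nn) with S a
    ... | true = +-nonneg 0≤w (valueAt-nonneg c a nn)
    ... | false = valueAt-nonneg c a nn

    valueAt-zero : ∀ c → NonNegative c → totalWeight F c ≡ 0# → ∀ a → valueAt F c a ≡ 0#
    valueAt-zero [] [] _ a = refl
    valueAt-zero ((w , S) ∷ c) (0≤w ∷ nn) w+c≡0 a with S a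
    ... | true = trans (cong₂ _+_ w≡0 (valueAt-zero c nn c≡0 a)) (+-identityˡ 0#)
      where
      w≡0 : w ≡ 0#
      w≡0 = nonneg-sum-zeroˡ 0≤w (totalWeight-nonneg c nn) w+c≡0
      c≡0 : totalWeight F c ≡ 0#
      c≡0 = nonneg-sum-zeroʳ 0≤w (totalWeight-nonneg c nn) w+c≡0
    ... | false = valueAt-zero c nn (nonneg-sum-zeroʳ 0≤w (totalWeight-nonneg c nn) w+c≡0) a

    valueAt-uniform : (c : Combination F A) (a : A) (β : Bool) → All (λ p → proj₂ p a ≡ β) c
                    → valueAt F c a ≡ (if β then totalWeight F c else 0#)
    valueAt-uniform [] a false [] = refl
    valueAt-uniform [] a true [] = refl
    valueAt-uniform ((w , S) ∷ c) a β (Sa≡β ∷ h) rewrite Sa≡β with β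
    ... | true = cong (w +_) (valueAt-uniform c a true h)
    ... | false = valueAt-uniform c a false h

    valueAt-split-head : ∀ {m} x y T (c : Combination F A) a → x + y ≡ m
      → valueAt F ((m , T) ∷ c) a ≡ valueAt F ((x , T) ∷ []) a + valueAt F ((y , T) ∷ c) a
    valueAt-split-head x y T c a refl with T a
    ... | true = trans (+-assoc x y (valueAt F c a)) (cong (_+ (y + valueAt F c a)) (sym (+-identityʳ x)))
    ... | false = sym (+-identityˡ (valueAt F c a))

    totalWeight-split-head : ∀ {m} x y T (c : Combination F A) → x + y ≡ m
      → totalWeight F ((m , T) ∷ c) ≡ totalWeight F ((x , T) ∷ []) + totalWeight F ((y , T) ∷ c)
    totalWeight-split-head x y T c refl =
      trans (+-assoc x y (totalWeight F c)) (cong (_+ (y + totalWeight F c)) (sym (+-identityʳ x)))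

    module _ (Q : (A → Bool) → Set) (w : A) where

      record Carving (l : Carrier) (c : Combination F A) : Set where
        field
          taken rest : Combination F A
          taken-nonneg : NonNegative taken
          rest-nonneg : NonNegative rest
          taken-ok : All (λ p → Q (proj₂ p) × proj₂ p w ≡ true) taken
          rest-ok : All (λ p → Q (proj₂ p)) rest
          taken-weight : totalWeight F taken ≡ l
          valueAt-split : ∀ a → valueAt F c a ≡ valueAt F taken a + valueAt F rest a
          totalWeight-split : totalWeight F c ≡ totalWeight F taken + totalWeight F rest

      -- Peel weight l off the sets containing w, splitting at most one of them in two.
      carve : ∀ l c → 0# ≤ l → l ≤ valueAt F c w → NonNegative c → All (λ p → Q (proj₂ p)) c
            → Carving l c
      carve l [] 0≤l l≤0 [] [] = record
        { taken = [] ; rest = [] ; taken-nonneg = [] ; rest-nonneg = [] ; taken-ok = [] ; rest-ok = []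
        ; taken-weight = ≤.antisym 0≤l l≤0
        ; valueAt-split = λ _ → sym (+-identityˡ 0#)
        ; totalWeight-split = sym (+-identityˡ 0#) }
      carve l ((m , T) ∷ c) 0≤l l≤v (0≤m ∷ nn) (q ∷ qs) with T w in Tw
      ... | false = record
        { taken = K.taken ; rest = (m , T) ∷ K.rest
        ; taken-nonneg = K.taken-nonneg ; rest-nonneg = 0≤m ∷ K.rest-nonneg
        ; taken-ok = K.taken-ok ; rest-ok = q ∷ K.rest-ok
        ; taken-weight = K.taken-weight
        ; valueAt-split = λ a → valueAt-∷-+ʳ m T c K.rest a _ (K.valueAt-split a)
        ; totalWeight-split = trans (cong (m +_) K.totalWeight-split) (x+[y+z]≡y+[x+z] m _ _) }
        where module K = Carving (carve l c 0≤l l≤v nn qs)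
      ... | true with ≤.total l m
      ...   | inj₁ l≤m = record
        { taken = (l , T) ∷ [] ; rest = (m + - l , T) ∷ c
        ; taken-nonneg = 0≤l ∷ [] ; rest-nonneg = x≤y⇒0≤y-x l≤m ∷ nn
        ; taken-ok = (q , Tw) ∷ [] ; rest-ok = q ∷ qs
        ; taken-weight = +-identityʳ l
        ; valueAt-split = λ a → valueAt-split-head l (m + - l) T c a (x+[y-x]≡y l m)
        ; totalWeight-split = totalWeight-split-head l (m + - l) T c (x+[y-x]≡y l m) }
      ...   | inj₂ m≤l = record
        { taken = (m , T) ∷ K.taken ; rest = K.rest
        ; taken-nonneg = 0≤m ∷ K.taken-nonneg ; rest-nonneg = K.rest-nonneg
        ; taken-ok = (q , Tw) ∷ K.taken-ok ; rest-ok = K.rest-ok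
        ; taken-weight = trans (cong (m +_) K.taken-weight) (x+[y-x]≡y m l)
        ; valueAt-split = λ a → valueAt-∷-+ˡ m T c K.taken a _ (K.valueAt-split a)
        ; totalWeight-split = trans (cong (m +_) K.totalWeight-split) (sym (+-assoc m _ _)) }
        where
        module K = Carving (carve (l + - m) c (x≤y⇒0≤y-x m≤l) (x≤y+z⇒x-y≤z m (valueAt F c w) l≤v) nn qs)

    valueAt-map-++ : ∀ {B : Set} (f : B → Carrier × (A → Bool)) (c d : List B) a
      → valueAt F (map f (c ++ d)) a ≡ valueAt F (map f c) a + valueAt F (map f d) a
    valueAt-map-++ f c d a =
      trans (cong (λ e → valueAt F e a) (map-++ f c d)) (valueAt-++ (map f c) (map f d) a)

    totalWeight-map-++ : ∀ {B : Set} (f : B → Carrier × (A → Bool)) (c d : List B)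
      → totalWeight F (map f (c ++ d)) ≡ totalWeight F (map f c) + totalWeight F (map f d)
    totalWeight-map-++ f c d =
      trans (cong (totalWeight F) (map-++ f c d)) (totalWeight-++ (map f c) (map f d))

  module _ {A : Set} where

    Pair : Set
    Pair = Carrier × (A → Bool) × (A → Bool)

    left right : Pair → Carrier × (A → Bool)
    left (w , S , _) = w , S
    right (w , _ , T) = w , T

    pairWith : (A → Bool) → Combination F A → List Pair
    pairWith S = map (λ (w , T) → w , S , T)

    left-pairWith-valueAt : ∀ S c a
      → valueAt F (map left (pairWith S c)) a ≡ (if S a then totalWeight F c else 0#)
    left-pairWith-valueAt S [] a with S a
    ... | true = refl
    ... | false = refl
    left-pairWith-valueAt S ((w , T) ∷ c) a with S a | left-pairWith-valueAt S c a
    ... | true | ih = cong (w +_) ih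
    ... | false | ih = ih

    left-pairWith-totalWeight : ∀ S c → totalWeight F (map left (pairWith S c)) ≡ totalWeight F c
    left-pairWith-totalWeight S [] = refl
    left-pairWith-totalWeight S ((w , T) ∷ c) = cong (w +_) (left-pairWith-totalWeight S c)

    right-pairWith : ∀ S c → map right (pairWith S c) ≡ c
    right-pairWith S c = trans (sym (map-∘ c)) (map-id c)

  module _ {A Z : Set} (P Q : (A → Bool) → Set) (pivot : Z → A)
    (pivots-agree : ∀ {S T} z → P S → Q T → S (pivot z) ≡ true → T (pivot z) ≡ true
                  → ∀ z′ → S (pivot z′) ≡ T (pivot z′)) where

    Matched : Pair → Set
    Matched (_ , S , T) = P S × Q T × ∃ λ z → S (pivot z) ≡ true × T (pivot z) ≡ true

    record Coupling (c₁ c₂ : Combination F A) : Set where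
      field
        pairs : List Pair
        pairs-nonneg : All (λ t → 0# ≤ proj₁ t) pairs
        pairs-matched : All Matched pairs
        left-valueAt : ∀ a → valueAt F (map left pairs) a ≡ valueAt F c₁ a
        right-valueAt : ∀ a → valueAt F (map right pairs) a ≡ valueAt F c₂ a
        left-totalWeight : totalWeight F (map left pairs) ≡ totalWeight F c₁

    extendCoupling : ∀ {l S c₁ c₂ z₀} → P S → S (pivot z₀) ≡ true
      → (K : Carving Q (pivot z₀) l c₂) → Coupling c₁ (Carving.rest K) → Coupling ((l , S) ∷ c₁) c₂
    extendCoupling {l} {S} {c₁} {c₂} {z₀} pS Sz₀ K R = record
      { pairs = pairWith S K.taken ++ R.pairs
      ; pairs-nonneg = Allₚ.++⁺ (Allₚ.map⁺ K.taken-nonneg) R.pairs-nonneg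
      ; pairs-matched = Allₚ.++⁺ (Allₚ.map⁺ (All.map (λ (q , Tz₀) → pS , q , z₀ , Sz₀ , Tz₀) K.taken-ok))
                                R.pairs-matched
      ; left-valueAt = λ a → begin
          valueAt F (map left (pairWith S K.taken ++ R.pairs)) a
            ≡⟨ valueAt-map-++ left (pairWith S K.taken) R.pairs a ⟩
          valueAt F (map left (pairWith S K.taken)) a + valueAt F (map left R.pairs) a
            ≡⟨ cong₂ _+_ (left-pairWith-valueAt S K.taken a) (R.left-valueAt a) ⟩
          (if S a then totalWeight F K.taken else 0#) + valueAt F c₁ a
            ≡⟨ cong (λ t → (if S a then t else 0#) + valueAt F c₁ a) K.taken-weight ⟩
          (if S a then l else 0#) + valueAt F c₁ a
            ≡⟨ valueAt-∷ l S c₁ a ⟨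
          valueAt F ((l , S) ∷ c₁) a ∎
      ; right-valueAt = λ a → begin
          valueAt F (map right (pairWith S K.taken ++ R.pairs)) a
            ≡⟨ valueAt-map-++ right (pairWith S K.taken) R.pairs a ⟩
          valueAt F (map right (pairWith S K.taken)) a + valueAt F (map right R.pairs) a
            ≡⟨ cong₂ _+_ (cong (λ c → valueAt F c a) (right-pairWith S K.taken)) (R.right-valueAt a) ⟩
          valueAt F K.taken a + valueAt F K.rest a
            ≡⟨ K.valueAt-split a ⟨
          valueAt F c₂ a ∎
      ; left-totalWeight = trans (totalWeight-map-++ left (pairWith S K.taken) R.pairs)
          (cong₂ _+_ (trans (left-pairWith-totalWeight S K.taken) K.taken-weight) R.left-totalWeight) }
      where
      module K = Carving K
      module R = Coupling R

    -- Match the first set S of c₁ against weight l of the sets of c₂ through its pivot; those sets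
    -- agree with S on all pivots, so what remains still has the same pivot values and total weight.
    couple : ∀ c₁ c₂ → NonNegative c₁ → NonNegative c₂
           → All (λ p → P (proj₂ p)) c₁ → All (λ p → Q (proj₂ p)) c₂
           → All (λ p → ∃ λ z → proj₂ p (pivot z) ≡ true) c₁
           → (∀ z → valueAt F c₁ (pivot z) ≡ valueAt F c₂ (pivot z))
           → totalWeight F c₁ ≡ totalWeight F c₂
           → Coupling c₁ c₂
    couple [] c₂ [] nn₂ [] _ [] _ tw≡ = record
      { pairs = [] ; pairs-nonneg = [] ; pairs-matched = []
      ; left-valueAt = λ _ → refl
      ; right-valueAt = λ a → sym (valueAt-zero c₂ nn₂ (sym tw≡) a)
      ; left-totalWeight = refl }
    couple ((l , S) ∷ c₁) c₂ (0≤l ∷ nn₁) nn₂ (pS ∷ ps) qs ((z₀ , Sz₀) ∷ pvs) va≡ tw≡ =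
      extendCoupling pS Sz₀ K (couple c₁ K.rest nn₁ K.rest-nonneg ps K.rest-ok pvs rest-valueAt rest-weight)
      where
      head-value : ∀ z → Carrier
      head-value z = if S (pivot z) then l else 0#

      l≤c₂ : l ≤ valueAt F c₂ (pivot z₀)
      l≤c₂ = subst (l ≤_) (begin
        l + valueAt F c₁ (pivot z₀)
          ≡⟨ cong (λ b → (if b then l else 0#) + valueAt F c₁ (pivot z₀)) Sz₀ ⟨
        head-value z₀ + valueAt F c₁ (pivot z₀) ≡⟨ valueAt-∷ l S c₁ (pivot z₀) ⟨
        valueAt F ((l , S) ∷ c₁) (pivot z₀)    ≡⟨ va≡ z₀ ⟩
        valueAt F c₂ (pivot z₀)                ∎) (x≤x+y l (valueAt-nonneg c₁ (pivot z₀) nn₁))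

      K : Carving Q (pivot z₀) l c₂
      K = carve Q (pivot z₀) l c₂ 0≤l l≤c₂ nn₂ qs
      module K = Carving K

      taken-valueAt : ∀ z → valueAt F K.taken (pivot z) ≡ head-value z
      taken-valueAt z = trans
        (valueAt-uniform K.taken (pivot z) (S (pivot z))
          (All.map (λ (q , Tz₀) → sym (pivots-agree z₀ pS q Sz₀ Tz₀ z)) K.taken-ok))
        (cong (λ t → if S (pivot z) then t else 0#) K.taken-weight)

      rest-valueAt : ∀ z → valueAt F c₁ (pivot z) ≡ valueAt F K.rest (pivot z)
      rest-valueAt z = +-cancelˡ (head-value z) _ _ (begin
        head-value z + valueAt F c₁ (pivot z)                    ≡⟨ valueAt-∷ l S c₁ (pivot z) ⟨
        valueAt F ((l , S) ∷ c₁) (pivot z)                       ≡⟨ va≡ z ⟩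
        valueAt F c₂ (pivot z)                                   ≡⟨ K.valueAt-split (pivot z) ⟩
        valueAt F K.taken (pivot z) + valueAt F K.rest (pivot z)
          ≡⟨ cong (_+ valueAt F K.rest (pivot z)) (taken-valueAt z) ⟩
        head-value z + valueAt F K.rest (pivot z)                ∎)

      rest-weight : totalWeight F c₁ ≡ totalWeight F K.rest
      rest-weight = +-cancelˡ l _ _
        (trans tw≡ (trans K.totalWeight-split (cong (_+ totalWeight F K.rest) K.taken-weight)))

  module _ {X A B : Set} where

    totalWeight-map : (f : X → Carrier × (A → Bool)) (g : X → Carrier × (B → Bool)) (xs : List X)
      → (∀ x → proj₁ (f x) ≡ proj₁ (g x)) → totalWeight F (map f xs) ≡ totalWeight F (map g xs)
    totalWeight-map f g [] _ = refl
    totalWeight-map f g (x ∷ xs) f≡g = cong₂ _+_ (f≡g x) (totalWeight-map f g xs f≡g)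

  module _ {X A : Set} where

    valueAt-map-cong : (f g : X → Carrier × (A → Bool)) (xs : List X) (a : A)
      → All (λ x → proj₁ (f x) ≡ proj₁ (g x) × proj₂ (f x) a ≡ proj₂ (g x) a) xs
      → valueAt F (map f xs) a ≡ valueAt F (map g xs) a
    valueAt-map-cong f g [] a [] = refl
    valueAt-map-cong f g (x ∷ xs) a ((w≡ , S≡) ∷ h) rewrite w≡ | S≡ with proj₂ (g x) a
    ... | true = cong (proj₁ (g x) +_) (valueAt-map-cong f g xs a h)
    ... | false = valueAt-map-cong f g xs a h

  module _ {A B : Set} (g : (A → Bool) → (B → Bool)) where

    mapSets : Combination F A → Combination F B
    mapSets = map (λ (w , S) → w , g S)

    totalWeight-mapSets : ∀ c → totalWeight F (mapSets c) ≡ totalWeight F c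
    totalWeight-mapSets [] = refl
    totalWeight-mapSets ((w , _) ∷ c) = cong (w +_) (totalWeight-mapSets c)

    valueAt-mapSets : ∀ c a b → (∀ S → g S b ≡ S a) → valueAt F (mapSets c) b ≡ valueAt F c a
    valueAt-mapSets [] a b _ = refl
    valueAt-mapSets ((w , S) ∷ c) a b gSb≡Sa rewrite gSb≡Sa S =
      cong (λ v → if S a then w + v else v) (valueAt-mapSets c a b gSb≡Sa)

  module _ {A B : Set} (HA : Graph A) (HB : Graph B) (f : B → A)
    (adj-f : ∀ b b′ → adj HB b b′ ≡ adj HA (f b) (f b′))
    (nodes-f : ∀ b → nodes HB b ≡ true → nodes HA (f b) ≡ true) where

    pullback : (A → Bool) → B → Bool
    pullback S b = S (f b) ∧ nodes HB b

    pullback-stable : ∀ S → Stable HA S → Stable HB (pullback S)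
    pullback-stable S (_ , independent) =
      (λ b Sb → ∧-conicalʳ _ _ Sb) ,
      λ b b′ Sb Sb′ →
        trans (adj-f b b′) (independent (f b) (f b′) (∧-conicalˡ _ _ Sb) (∧-conicalˡ _ _ Sb′))

    InP-pullback : (LA : List (A → Bool)) (LB : List (B → Bool))
      → (∀ S → Stable HA S → All (Meets S) LA → All (Meets (pullback S)) LB)
      → ∀ x → InP F HA LA x → InP F HB LB (x ∘ f)
    InP-pullback LA LB meets x (c , nn , tw≡1 , valid , x≡) =
      mapSets pullback c , Allₚ.map⁺ nn , trans (totalWeight-mapSets pullback c) tw≡1 ,
      Allₚ.map⁺ (All.map (λ (st , ms) → pullback-stable _ st , meets _ st ms) valid) ,
      λ b b∈HB → trans (x≡ (f b) (nodes-f b b∈HB))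
        (sym (valueAt-mapSets pullback c (f b) b (λ S → trans (cong (S (f b) ∧_) b∈HB) (∧-identityʳ _))))

module RecordGraphs {n : ℕ} (E : Fin n → Fin n → Bool) (U : Subset n) where
  open import Data.Product using (_,_)

  G : Graph (Fin n)
  G = mkGraph E

  Node : Set
  Node = RecNode G U

  Rec : Graph (Fin n) → Graph Node
  Rec = recordGraph G U

  sameSubset : Subset n → Subset n → Bool
  sameSubset R R′ = ⌊ ≡-dec _≟ᵇ_ R R′ ⌋

  sameSubset-sym : ∀ R R′ → sameSubset R R′ ≡ sameSubset R′ R
  sameSubset-sym R R′ with ≡-dec _≟ᵇ_ R R′ | ≡-dec _≟ᵇ_ R′ R
  ... | yes _ | yes _ = refl
  ... | no _ | no _ = refl
  ... | yes R≡R′ | no R′≢R = ⊥-elim (R′≢R (sym R≡R′))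
  ... | no R≢R′ | yes R′≡R = ⊥-elim (R≢R′ (sym R′≡R))

  Rec-G-nodes : ∀ a → nodes (Rec G) a ≡ true
  Rec-G-nodes (inj₁ _) = refl
  Rec-G-nodes (inj₂ _) = refl

  Rec-induced-adj : ∀ X a b → adj (Rec (G [ X ])) a b ≡ adj (Rec G) a b
  Rec-induced-adj X (inj₁ _) (inj₁ _) = refl
  Rec-induced-adj X (inj₁ _) (inj₂ _) = refl
  Rec-induced-adj X (inj₂ _) (inj₁ _) = refl
  Rec-induced-adj X (inj₂ _) (inj₂ _) = refl

  Rec-adj-sym : (∀ u v → E u v ≡ E v u) → ∀ a b → adj (Rec G) a b ≡ adj (Rec G) b a
  Rec-adj-sym E-sym (inj₁ u) (inj₁ v) = E-sym u v
  Rec-adj-sym E-sym (inj₁ _) (inj₂ _) = refl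
  Rec-adj-sym E-sym (inj₂ _) (inj₁ _) = refl
  Rec-adj-sym E-sym (inj₂ (R , _)) (inj₂ (R′ , _)) = cong not (sameSubset-sym R R′)

  All-LU : ∀ {p} {P : (Node → Bool) → Set p}
         → P (RClique G U) → (∀ v → v ∈ₛ U → P (vClique G U v)) → All P (LU G U)
  All-LU PR Pv = PR ∷ Allₚ.map⁺ (All.map (λ {v} Uv → Pv v (Equivalence.to T-≡ Uv))
                                         (Allₚ.all-filter (T? ∘ lookup U) (allFin n)))

  LU-vClique : ∀ {p} {P : (Node → Bool) → Set p} {u} → u ∈ₛ U → All P (LU G U) → P (vClique G U u)
  LU-vClique {u = u} u∈U PLU =
    All.lookup (All.tail PLU)
      (∈-map⁺ (vClique G U) (∈-filter⁺ (T? ∘ lookup U) (∈-allFin u) (Equivalence.from T-≡ u∈U)))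

  module Trace {H : Graph (Fin n)} {S : Node → Bool}
    (stable : Stable (Rec H) S) (meets : All (Meets S) (LU G U)) where

    selects-record : ∃ λ z → S (inj₂ z) ≡ true
    selects-record with All.head meets
    ... | inj₂ z , Sz , _ = z , Sz

    record-unique : ∀ {R p} → S (inj₂ (R , p)) ≡ true → ∀ z → S (inj₂ z) ≡ sameSubset R (proj₁ z)
    record-unique {R} {p} SR (R′ , p′) with S (inj₂ (R′ , p′)) in SR′
    ... | true = sym (not-injective (proj₂ stable (inj₂ (R , p)) (inj₂ (R′ , p′)) SR SR′))
    ... | false with ≡-dec _≟ᵇ_ R R′
    ...   | no _ = refl
    ...   | yes refl = trans (sym SR′) (subst (λ q → S (inj₂ (R , q)) ≡ true) (T-irrelevant p p′) SR)

    trace-on-U : ∀ {R p} → S (inj₂ (R , p)) ≡ true → ∀ u → u ∈ₛ U → S (inj₁ u) ≡ lookup R u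
    trace-on-U {R} {p} SR u u∈U with S (inj₁ u) in Su
    ... | true = sym (not-injective (subst (λ b → b ∧ not (lookup R u) ≡ false) u∈U
                   (proj₂ stable (inj₁ u) (inj₂ (R , p)) Su SR)))
    ... | false with lookup R u in Ru | LU-vClique u∈U meets
    ...   | false | _ = refl
    ...   | true | inj₁ u′ , Su′ , u′≟u with isYes-sound (u′ ≟ u) u′≟u
    ...     | refl = trans (sym Su) Su′
    trace-on-U {R} {p} SR u u∈U | false | true | inj₂ (R′ , p′) , SR′ , R′u
      with isYes-sound (≡-dec _≟ᵇ_ R R′) (trans (sym (record-unique SR (R′ , p′))) SR′)
    ...     | refl = trans (sym (not-injective R′u)) Ru

  ∈-∪ˡ : ∀ X {u} → u ∈ₛ X → u ∈ₛ (X ∪ U)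
  ∈-∪ˡ X {u} u∈X = trans (lookup-zipWith _∨_ u X U) (cong (_∨ lookup U u) u∈X)

  ∈-∪ʳ : ∀ X {u} → u ∈ₛ U → u ∈ₛ (X ∪ U)
  ∈-∪ʳ X {u} u∈U = trans (lookup-zipWith _∨_ u X U) (trans (cong (lookup X u ∨_) u∈U) (∨-zeroʳ _))

  ∈-∪-∉ʳ : ∀ X {u} → u ∈ₛ (X ∪ U) → lookup U u ≡ false → u ∈ₛ X
  ∈-∪-∉ʳ X {u} u∈X∪U u∉U = begin
    lookup X u                ≡⟨ ∨-identityʳ _ ⟨
    lookup X u ∨ false        ≡⟨ cong (lookup X u ∨_) u∉U ⟨
    lookup X u ∨ lookup U u   ≡⟨ lookup-zipWith _∨_ u X U ⟨
    lookup (X ∪ U) u          ≡⟨ u∈X∪U ⟩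
    true                      ∎
    where open ≡-Reasoning

  Partition : Subset n → Subset n → Set
  Partition V₁ V₂ = ∀ v → (v ∈ₛ V₁ × lookup U v ≡ false × lookup V₂ v ≡ false)
                        ⊎ (lookup V₁ v ≡ false × v ∈ₛ U × lookup V₂ v ≡ false)
                        ⊎ (lookup V₁ v ≡ false × lookup U v ≡ false × v ∈ₛ V₂)

  Nonadjacent : Subset n → Subset n → Set
  Nonadjacent V₁ V₂ = ∀ u v → u ∈ₛ V₁ → v ∈ₛ V₂ → E u v ≡ false

  Valid : Graph Node → List (Node → Bool) → (Node → Bool) → Set
  Valid H L S = Stable H S × All (Meets S) L

  module Separation (E-sym : ∀ u v → E u v ≡ E v u) (V₁ V₂ : Subset n)
    (partition : Partition V₁ V₂) (nonadjacent : Nonadjacent V₁ V₂)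
    (L₁ L₂ : List (Subset n)) where

    G₁ G₂ : Graph Node
    G₁ = Rec (G [ V₁ ∪ U ])
    G₂ = Rec (G [ V₂ ∪ U ])

    K₁ K₂ K : List (Node → Bool)
    K₁ = liftCliques G U L₁ ++ LU G U
    K₂ = liftCliques G U L₂ ++ LU G U
    K = liftCliques G U L₁ ++ liftCliques G U L₂ ++ LU G U

    Compatible : (Node → Bool) → (Node → Bool) → Set
    Compatible S T = Valid G₁ K₁ S × Valid G₂ K₂ T
                   × ∃ λ z → S (inj₂ z) ≡ true × T (inj₂ z) ≡ true

    module Trace₁ {S} (v : Valid G₁ K₁ S) = Trace (proj₁ v) (Allₚ.++⁻ʳ (liftCliques G U L₁) (proj₂ v))
    module Trace₂ {T} (v : Valid G₂ K₂ T) = Trace (proj₁ v) (Allₚ.++⁻ʳ (liftCliques G U L₂) (proj₂ v))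

    records-agree : ∀ {S T} z → Valid G₁ K₁ S → Valid G₂ K₂ T
                  → S (inj₂ z) ≡ true → T (inj₂ z) ≡ true → ∀ z′ → S (inj₂ z′) ≡ T (inj₂ z′)
    records-agree _ vS vT Sz Tz z′ =
      trans (Trace₁.record-unique vS Sz z′) (sym (Trace₂.record-unique vT Tz z′))

    agree-on-records : ∀ {S T} → Compatible S T → ∀ z → S (inj₂ z) ≡ T (inj₂ z)
    agree-on-records (vS , vT , z , Sz , Tz) = records-agree z vS vT Sz Tz

    agree-on-U : ∀ {S T} → Compatible S T → ∀ {u} → u ∈ₛ U → S (inj₁ u) ≡ T (inj₁ u)
    agree-on-U (vS , vT , _ , Sz , Tz) {u} u∈U =
      trans (Trace₁.trace-on-U vS Sz u u∈U) (sym (Trace₂.trace-on-U vT Tz u u∈U))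

    agree-or-outside-U : ∀ {S T} → Compatible S T
                       → ∀ a → S a ≡ T a ⊎ ∃ λ u → a ≡ inj₁ u × lookup U u ≡ false
    agree-or-outside-U c (inj₂ z) = inj₁ (agree-on-records c z)
    agree-or-outside-U c (inj₁ u) with lookup U u in u∈U
    ... | true = inj₁ (agree-on-U c u∈U)
    ... | false = inj₂ (u , refl , u∈U)

    excludes-outside : ∀ X {S u} → Stable (Rec (G [ X ∪ U ])) S → lookup X u ≡ false → lookup U u ≡ false
           → S (inj₁ u) ≡ false
    excludes-outside X {S} {u} (inside , _) u∉X u∉U with S (inj₁ u) in Su
    ... | false = refl
    ... | true = trans (sym (∈-∪-∉ʳ X (inside (inj₁ u) Su) u∉U)) u∉X

    union : (Node → Bool) → (Node → Bool) → Node → Bool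
    union S T a = S a ∨ T a

    union-stable : ∀ {S T} → Compatible S T → Stable (Rec G) (union S T)
    union-stable {S} {T} c@((stS , _) , (stT , _) , _) = (λ a _ → Rec-G-nodes a) , independent
      where
      within-S : ∀ a b → S a ≡ true → S b ≡ true → adj (Rec G) a b ≡ false
      within-S a b Sa Sb = trans (sym (Rec-induced-adj (V₁ ∪ U) a b)) (proj₂ stS a b Sa Sb)
      within-T : ∀ a b → T a ≡ true → T b ≡ true → adj (Rec G) a b ≡ false
      within-T a b Ta Tb = trans (sym (Rec-induced-adj (V₂ ∪ U) a b)) (proj₂ stT a b Ta Tb)
      across : ∀ a b → S a ≡ true → T b ≡ true → adj (Rec G) a b ≡ false
      across a b Sa Tb with agree-or-outside-U c a | agree-or-outside-U c b
      ... | inj₁ Sa≡Ta | _ = within-T a b (trans (sym Sa≡Ta) Sa) Tb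
      ... | inj₂ _ | inj₁ Sb≡Tb = within-S a b Sa (trans Sb≡Tb Tb)
      ... | inj₂ (u , refl , u∉U) | inj₂ (v , refl , v∉U) =
        nonadjacent u v (∈-∪-∉ʳ V₁ (proj₁ stS (inj₁ u) Sa) u∉U) (∈-∪-∉ʳ V₂ (proj₁ stT (inj₁ v) Tb) v∉U)
      independent : ∀ a b → union S T a ≡ true → union S T b ≡ true → adj (Rec G) a b ≡ false
      independent a b STa STb with ∨-true (S a) STa | ∨-true (S b) STb
      ... | inj₁ Sa | inj₁ Sb = within-S a b Sa Sb
      ... | inj₂ Ta | inj₂ Tb = within-T a b Ta Tb
      ... | inj₁ Sa | inj₂ Tb = across a b Sa Tb
      ... | inj₂ Ta | inj₁ Sb = trans (Rec-adj-sym E-sym a b) (across b a Sb Ta)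

    union-meets : ∀ {S T} → Compatible S T → All (Meets (union S T)) K
    union-meets {S} {T} ((_ , mS) , (_ , mT) , _) =
      Allₚ.++⁺ (All.map meets-via-S (Allₚ.++⁻ˡ (liftCliques G U L₁) mS))
               (Allₚ.++⁺ (All.map meets-via-T (Allₚ.++⁻ˡ (liftCliques G U L₂) mT))
                         (All.map meets-via-S (Allₚ.++⁻ʳ (liftCliques G U L₁) mS)))
      where
      meets-via-S : ∀ {C} → Meets S C → Meets (union S T) C
      meets-via-S (a , Sa , Ca) = a , cong (_∨ T a) Sa , Ca
      meets-via-T : ∀ {C} → Meets T C → Meets (union S T) C
      meets-via-T (a , Ta , Ca) = a , trans (cong (S a ∨_) Ta) (∨-zeroʳ (S a)) , Ca

    LeftSide RightSide : Node → Set
    LeftSide a = nodes G₁ a ≡ true × ∀ {S T} → Compatible S T → union S T a ≡ S a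
    RightSide a = nodes G₂ a ≡ true × ∀ {S T} → Compatible S T → union S T a ≡ T a

    side : ∀ a → LeftSide a ⊎ RightSide a
    side (inj₂ z) = inj₂ (refl , λ c → ∨-agree (agree-on-records c z))
    side (inj₁ u) with partition u
    ... | inj₁ (u∈V₁ , u∉U , u∉V₂) =
      inj₁ (∈-∪ˡ V₁ u∈V₁ , λ { {S} (_ , (stT , _) , _) →
        trans (cong (S (inj₁ u) ∨_) (excludes-outside V₂ stT u∉V₂ u∉U)) (∨-identityʳ _) })
    ... | inj₂ (inj₁ (_ , u∈U , _)) = inj₂ (∈-∪ʳ V₂ u∈U , λ c → ∨-agree (agree-on-U c u∈U))
    ... | inj₂ (inj₂ (u∉V₁ , u∉U , u∈V₂)) =
      inj₂ (∈-∪ˡ V₂ u∈V₂ , λ { ((stS , _) , _) → cong (_∨ _) (excludes-outside V₁ stS u∉V₁ u∉U) })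

  Inside : Graph Node → (Node → Bool) → Set
  Inside H C = ∀ a → C a ≡ true → nodes H a ≡ true

  LU-inside : ∀ X → (∀ u → u ∈ₛ U → u ∈ₛ X) → All (Inside (Rec (G [ X ]))) (LU G U)
  LU-inside X U⊆X = All-LU (λ { (inj₁ _) () ; (inj₂ _) _ → refl }) λ v v∈U →
    λ { (inj₁ u) u≟v → subst (_∈ₛ X) (sym (isYes-sound (u ≟ v) u≟v)) (U⊆X v v∈U) ; (inj₂ _) _ → refl }

  lifted-inside : ∀ X {L} → All (CliqueₛOf (G [ X ])) L → All (Inside (Rec (G [ X ]))) (liftCliques G U L)
  lifted-inside X cliques =
    Allₚ.map⁺ (All.map (λ (inside , _) → λ { (inj₁ v) Cv → inside v Cv ; (inj₂ _) () }) cliques)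

  meets-inside : ∀ {H S C} → Inside H C → Meets S C → Meets (λ a → S a ∧ nodes H a) C
  meets-inside inside (a , Sa , Ca) = a , trans (cong (_∧ _) Sa) (inside a Ca) , Ca

  allᵇ-true : ∀ {p : Fin n → Bool} xs → (∀ x → p x ≡ true) → allᵇ p xs ≡ true
  allᵇ-true [] _ = refl
  allᵇ-true {p} (x ∷ xs) p≡true rewrite p≡true x = allᵇ-true xs p≡true

  trace : (Fin n → Bool) → Subset n
  trace S = tabulate (λ v → S v ∧ lookup U v)

  lookup-trace : ∀ S v → lookup (trace S) v ≡ S v ∧ lookup U v
  lookup-trace S = lookup∘tabulate (λ v → S v ∧ lookup U v)

  trace-stable : ∀ {S} → Stable G S → T (stableᵇ (G [ U ]) (trace S))
  trace-stable {S} (_ , independent) = subst T (sym (allᵇ-true (allFin n) row)) tt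
    where
    entry : ∀ u → S u ≡ true → ∀ v → not (lookup (trace S) v) ∨ not (E u v) ≡ true
    entry u Su v rewrite lookup-trace S v with S v in Sv | lookup U v
    ... | false | _ = refl
    ... | true | false = refl
    ... | true | true rewrite independent u v Su Sv = refl
    row : ∀ u → not (lookup (trace S) u)
                ∨ (true ∧ lookup U u ∧ allᵇ (λ v → not (lookup (trace S) v) ∨ not (E u v)) (allFin n)) ≡ true
    row u rewrite lookup-trace S u with S u in Su | lookup U u
    ... | false | _ = refl
    ... | true | false = refl
    ... | true | true = allᵇ-true (allFin n) (entry u Su)

  extend : (Fin n → Bool) → Node → Bool
  extend S (inj₁ v) = S v
  extend S (inj₂ (R , _)) = sameSubset (trace S) R

  sameSubset-refl : ∀ R → sameSubset R R ≡ true
  sameSubset-refl R = isYes-complete (≡-dec _≟ᵇ_ R R) refl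

  trace-complement-nonadjacent : ∀ {S u} → S u ≡ true → lookup U u ∧ not (lookup (trace S) u) ≡ false
  trace-complement-nonadjacent {S} {u} Su rewrite lookup-trace S u | Su with lookup U u
  ... | true = refl
  ... | false = refl

  extend-stable : ∀ {S} → Stable G S → Stable (Rec G) (extend S)
  extend-stable {S} (_ , independent) = (λ a _ → Rec-G-nodes a) , nonadjacent
    where
    nonadjacent : ∀ a b → extend S a ≡ true → extend S b ≡ true → adj (Rec G) a b ≡ false
    nonadjacent (inj₁ u) (inj₁ v) Su Sv = independent u v Su Sv
    nonadjacent (inj₁ u) (inj₂ (R , _)) Su SR with isYes-sound (≡-dec _≟ᵇ_ (trace S) R) SR
    ... | refl = trace-complement-nonadjacent Su
    nonadjacent (inj₂ (R , _)) (inj₁ u) SR Su with isYes-sound (≡-dec _≟ᵇ_ (trace S) R) SR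
    ... | refl = trace-complement-nonadjacent Su
    nonadjacent (inj₂ (R , _)) (inj₂ (R′ , _)) SR SR′
      with isYes-sound (≡-dec _≟ᵇ_ (trace S) R) SR | isYes-sound (≡-dec _≟ᵇ_ (trace S) R′) SR′
    ... | refl | refl = cong not (sameSubset-refl (trace S))

  extend-meets : ∀ {S} → Stable G S → All (Meets (extend S)) (LU G U)
  extend-meets {S} stable = All-LU (r , sameSubset-refl (trace S) , refl) meets-vClique
    where
    r : Node
    r = inj₂ (trace S , trace-stable stable)
    meets-vClique : ∀ v → v ∈ₛ U → Meets (extend S) (vClique G U v)
    meets-vClique v _ with S v in Sv
    ... | true = inj₁ v , Sv , isYes-complete (v ≟ v) refl
    ... | false = r , sameSubset-refl (trace S) , cong not (trans (lookup-trace S v) (cong (_∧ _) Sv))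

module RecordPolytopes (F : OrderedField) {n : ℕ} (E : Fin n → Fin n → Bool) (U : Subset n) where
  open import Data.Product using (_,_)
  open OrderedField F using (Carrier)
  open Combinations F
  open RecordGraphs E U

  InP-restrict : ∀ X {L K} → (∀ u → u ∈ₛ U → u ∈ₛ X) → All (CliqueₛOf (G [ X ])) L
    → (∀ {S} → All (Meets S) K → All (Meets S) (liftCliques G U L ++ LU G U))
    → ∀ x → InP F (Rec G) K x → InP F (Rec (G [ X ])) (liftCliques G U L ++ LU G U) x
  InP-restrict X {L} {K} U⊆X cliques sub =
    InP-pullback (Rec G) (Rec (G [ X ])) (λ a → a) (Rec-induced-adj X) (λ a _ → Rec-G-nodes a)
      K (liftCliques G U L ++ LU G U)
      (λ _ _ ms → All.zipWith (λ (inside , m) → meets-inside {Rec (G [ X ])} inside m)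
                    (Allₚ.++⁺ (lifted-inside X cliques) (LU-inside X U⊆X) , sub ms))

  InP-forget-records : ∀ x y → InP F (Rec G) (LU G U) ([_,_] x y) → InP F G [] x
  InP-forget-records x y =
    InP-pullback (Rec G) G inj₁ (λ _ _ → refl) (λ _ _ → refl) (LU G U) [] (λ _ _ _ → []) ([_,_] x y)

  InP-extend : ∀ x → InP F G [] x → ∃ λ (y : RNode G U → Carrier) → InP F (Rec G) (LU G U) ([_,_] x y)
  InP-extend x (c , nn , tw≡1 , valid , x≡) =
    (λ r → valueAt F (mapSets extend c) (inj₂ r)) ,
    mapSets extend c , Allₚ.map⁺ nn , trans (totalWeight-mapSets extend c) tw≡1 ,
    Allₚ.map⁺ (All.map (λ (stable , _) → extend-stable stable , extend-meets stable) valid) ,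
    λ { (inj₁ v) _ → trans (x≡ v refl) (sym (valueAt-mapSets extend c v (inj₁ v) (λ _ → refl)))
      ; (inj₂ _) _ → refl }

  module Decomposition (E-sym : ∀ u v → E u v ≡ E v u) (V₁ V₂ : Subset n)
    (partition : Partition V₁ V₂) (nonadjacent : Nonadjacent V₁ V₂)
    (L₁ L₂ : List (Subset n)) where

    open Separation E-sym V₁ V₂ partition nonadjacent L₁ L₂

    split : All (CliqueₛOf (G [ V₁ ∪ U ])) L₁ → All (CliqueₛOf (G [ V₂ ∪ U ])) L₂
          → ∀ x → InP F (Rec G) K x → InP F G₁ K₁ x × InP F G₂ K₂ x
    split cliques₁ cliques₂ x h =
      InP-restrict (V₁ ∪ U) (λ _ → ∈-∪ʳ V₁) cliques₁ K⊇K₁ x h ,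
      InP-restrict (V₂ ∪ U) (λ _ → ∈-∪ʳ V₂) cliques₂ (Allₚ.++⁻ʳ (liftCliques G U L₁)) x h
      where
      K⊇K₁ : ∀ {S} → All (Meets S) K → All (Meets S) K₁
      K⊇K₁ ms = Allₚ.++⁺ (Allₚ.++⁻ˡ (liftCliques G U L₁) ms)
                         (Allₚ.++⁻ʳ (liftCliques G U L₂) (Allₚ.++⁻ʳ (liftCliques G U L₁) ms))

    glue : ∀ x → InP F G₁ K₁ x → InP F G₂ K₂ x → InP F (Rec G) K x
    glue x (c₁ , nn₁ , tw₁ , valid₁ , x≡₁) (c₂ , nn₂ , tw₂ , valid₂ , x≡₂) =
      map merge C.pairs , Allₚ.map⁺ C.pairs-nonneg ,
      trans (totalWeight-map merge left C.pairs (λ _ → refl)) (trans C.left-totalWeight tw₁) ,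
      Allₚ.map⁺ (All.map (λ m → union-stable m , union-meets m) C.pairs-matched) ,
      value
      where
      C : Coupling (Valid G₁ K₁) (Valid G₂ K₂) inj₂ records-agree c₁ c₂
      C = couple (Valid G₁ K₁) (Valid G₂ K₂) inj₂ records-agree c₁ c₂ nn₁ nn₂ valid₁ valid₂
            (All.map Trace₁.selects-record valid₁)
            (λ z → trans (sym (x≡₁ (inj₂ z) refl)) (x≡₂ (inj₂ z) refl))
            (trans tw₁ (sym tw₂))
      module C = Coupling C
      merge : Pair → Carrier × (Node → Bool)
      merge (w , S , T) = w , union S T
      value : ∀ a → nodes (Rec G) a ≡ true → x a ≡ valueAt F (map merge C.pairs) a
      value a _ with side a
      ... | inj₁ (a∈G₁ , union≡S) = trans (x≡₁ a a∈G₁) (trans (sym (C.left-valueAt a))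
              (valueAt-map-cong left merge C.pairs a
                (All.map (λ m → refl , sym (union≡S m)) C.pairs-matched)))
      ... | inj₂ (a∈G₂ , union≡T) = trans (x≡₂ a a∈G₂) (trans (sym (C.right-valueAt a))
              (valueAt-map-cong right merge C.pairs a
                (All.map (λ m → refl , sym (union≡T m)) C.pairs-matched)))

    decomposition : All (CliqueₛOf (G [ V₁ ∪ U ])) L₁ → All (CliqueₛOf (G [ V₂ ∪ U ])) L₂
      → ∀ x → InP F (Rec G) K x ⇔ (InP F G₁ K₁ x × InP F G₂ K₂ x)
    decomposition cliques₁ cliques₂ x = mk⇔ (split cliques₁ cliques₂ x) (λ (h₁ , h₂) → glue x h₁ h₂)

  projection : (∀ u v → E u v ≡ E v u) → (V₁ V₂ : Subset n) → Partition V₁ V₂ → Nonadjacent V₁ V₂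
    → ∀ x → InP F G [] x ⇔ (∃ λ (y : RNode G U → Carrier)
                              → InP F (Rec (G [ V₁ ∪ U ])) (LU G U) ([_,_] x y)
                              × InP F (Rec (G [ V₂ ∪ U ])) (LU G U) ([_,_] x y))
  projection E-sym V₁ V₂ partition nonadjacent x = mk⇔
    (λ h → let (y , h′) = InP-extend x h in y , split [] [] ([_,_] x y) h′)
    (λ (y , h₁ , h₂) → InP-forget-records x y (glue ([_,_] x y) h₁ h₂))
    where open Decomposition E-sym V₁ V₂ partition nonadjacent [] []

theorem9 : (F : OrderedField) (n : ℕ) (E : Fin n → Fin n → Bool)
  → (∀ u v → E u v ≡ E v u) → (∀ v → E v v ≡ false)
  → (V₁ U V₂ : Subset n) (𝒰 : List (Subset n))
  → NodeCutsetSeparation (mkGraph E) V₁ U V₂ 𝒰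
  → (L₁ L₂ : List (Subset n))
  → All (CliqueₛOf (mkGraph E [ V₁ ∪ U ])) L₁
  → All (CliqueₛOf (mkGraph E [ V₂ ∪ U ])) L₂
  → ((x : RecNode (mkGraph E) U → OrderedField.Carrier F)
      → InP F (recordGraph (mkGraph E) U (mkGraph E))
          (liftCliques (mkGraph E) U L₁ ++ liftCliques (mkGraph E) U L₂ ++ LU (mkGraph E) U) x
        ⇔ (InP F (recordGraph (mkGraph E) U (mkGraph E [ V₁ ∪ U ]))
             (liftCliques (mkGraph E) U L₁ ++ LU (mkGraph E) U) x
           × InP F (recordGraph (mkGraph E) U (mkGraph E [ V₂ ∪ U ]))
             (liftCliques (mkGraph E) U L₂ ++ LU (mkGraph E) U) x))
    × ((x : Fin n → OrderedField.Carrier F)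
      → InP F (mkGraph E) [] x
        ⇔ (∃ λ (y : RNode (mkGraph E) U → OrderedField.Carrier F)
             → InP F (recordGraph (mkGraph E) U (mkGraph E [ V₁ ∪ U ])) (LU (mkGraph E) U) [ x , y ]
             × InP F (recordGraph (mkGraph E) U (mkGraph E [ V₂ ∪ U ])) (LU (mkGraph E) U) [ x , y ]))
theorem9 F n E E-sym _ V₁ U V₂ _ sep L₁ L₂ cliques₁ cliques₂ =
  decomposition cliques₁ cliques₂ ,′ projection E-sym V₁ V₂ partition nonadjacent
  where
  open RecordGraphs E U using (Partition; Nonadjacent)
  open RecordPolytopes F E U
  partition : Partition V₁ V₂
  partition = proj₁ sep
  nonadjacent : Nonadjacent V₁ V₂
  nonadjacent = proj₁ (proj₂ (proj₂ sep))
  open Decomposition E-sym V₁ V₂ partition nonadjacent L₁ L₂
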